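{- Let $n\ge1$, $a,k\in[2n]$ and $\ell\in[n]$. Then $$\big|\{P\in\mathcal{D}_n: u_{a,k}(P)=\ell\}\big|=\big|\{P\in\mathcal{D}_n: h_k(P)=\ell\}\big|.$$
   Context: A Dyck path of size $n$ is a word $P_1\cdots P_{2n}$ in $\mathtt{u},\mathtt{d}$ with $n$ of each letter whose every prefix has at least as many $\mathtt{u}$'s as $\mathtt{d}$'s; $\mathcal{D}_n$ is their set. The tunneling $\tau_P\in S_{2n}$ is the fixed-point-free involution pairing each up-step position with the position of its matching down-step. The height $h_k(P)$ is the number of $\mathtt{u}$'s minus the number of $\mathtt{d}$'s among $P_1,\dots,P_k$. For $S\subseteq[2n]$, a step $i\in S$ is unpaired in $S$ if $\tau_P(i)\notin S$. $u_{a,k}(P)$ is the number of unpaired steps in $I=\{a,a+1,\dots,a+k-1\}$ (indices modulo $2n$, in $[2n]$). -}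

module Defs where

open import Data.Nat using (ℕ; zero; suc; _+_; _*_; _∸_; _%_; _≡ᵇ_)
open import Data.Bool using (Bool; true; false; not; _∧_; _∨_; if_then_else_)
open import Data.List using (List; []; _∷_; map; _++_; filterᵇ; length; upTo; take)
open import Data.Bool.ListAction using (any)
open import Data.Product using (_×_; _,_)
open import Data.Integer using (ℤ; +_; -[1+_]) renaming (_+_ to _+ℤ_)
open import Data.Integer.Properties using () renaming (_≟_ to _≟ℤ_)
open import Relation.Nullary.Decidable using (⌊_⌋)

data Step : Set where
  U D : Step

words : ℕ → List (List Step)
words zero = [] ∷ []
words (suc m) = map (U ∷_) (words m) ++ map (D ∷_) (words m)

dyckFrom : ℕ → List Step → Bool
dyckFrom h [] = h ≡ᵇ 0
dyckFrom h (U ∷ w) = dyckFrom (suc h) w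
dyckFrom zero (D ∷ w) = false
dyckFrom (suc h) (D ∷ w) = dyckFrom h w

isDyck : List Step → Bool
isDyck = dyckFrom 0

Dyck : ℕ → List (List Step)
Dyck n = filterᵇ isDyck (words (2 * n))

count : ℕ → (List Step → Bool) → ℕ
count n p = length (filterᵇ p (Dyck n))

-- matching pairs (up-position, matching down-position), positions 1-indexed,
-- computed with the usual stack of open up-steps
matchFrom : ℕ → List ℕ → List Step → List (ℕ × ℕ)
matchFrom i st [] = []
matchFrom i st (U ∷ w) = matchFrom (suc i) (i ∷ st) w
matchFrom i [] (D ∷ w) = matchFrom (suc i) [] w
matchFrom i (j ∷ st) (D ∷ w) = (j , i) ∷ matchFrom (suc i) st w

matching : List Step → List (ℕ × ℕ)
matching = matchFrom 1 []

lookupPartner : List (ℕ × ℕ) → ℕ → ℕ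
lookupPartner [] x = 0
lookupPartner ((j , i) ∷ ps) x =
  if j ≡ᵇ x then i else (if i ≡ᵇ x then j else lookupPartner ps x)

tunnel : List Step → ℕ → ℕ
tunnel P = lookupPartner (matching P)

stepVal : Step → ℤ
stepVal U = + 1
stepVal D = -[1+ 0 ]

heightAll : List Step → ℤ
heightAll [] = + 0
heightAll (s ∷ w) = stepVal s +ℤ heightAll w

height : ℕ → List Step → ℤ
height k P = heightAll (take k P)

-- the t-th element (t = 0..k-1) of the cyclic interval {a, a+1, …, a+k−1} ⊆ [2n]
-- (indices taken modulo 2n, represented in 1..2n)
cyc : ℕ → ℕ → ℕ → ℕ
cyc zero a t = a + t
cyc (suc m) a t = suc ((a ∸ 1 + t) % (2 * suc m))

inInterval : ℕ → ℕ → ℕ → ℕ → Bool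
inInterval n a k x = any (λ t → cyc n a t ≡ᵇ x) (upTo k)

unpaired : ℕ → ℕ → ℕ → List Step → ℕ
unpaired n a k P =
  length (filterᵇ (λ t → not (inInterval n a k (tunnel P (cyc n a t)))) (upTo k))

heightIs : ℕ → ℕ → List Step → Bool
heightIs k ℓ P = ⌊ height k P ≟ℤ + ℓ ⌋

-- For a = 1 the interval is {1, …, k}, and the steps of it paired outside it are exactly the
-- up-steps of P₁ ⋯ P_k still open after step k, so u_{1,k}(P) = h_k(P).  Writing P = U X D Y with
-- X, Y Dyck, the path rotate P = X U Y D is again Dyck, and its tunneling is that of P conjugated
-- by the cyclic shift i ↦ i + 1 of [2n]; hence u_{a+1,k}(P) = u_{a,k}(rotate P).  Since rotate is
-- a bijection of 𝒟ₙ (its inverse is rotate conjugated by reversal), the distribution of u_{a,k}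
-- does not depend on a.
module Submission where

open import Defs
open import Data.Bool using (Bool; true; false; not; if_then_else_; T)
open import Data.Bool.ListAction using (or)
open import Data.Bool.Properties using (T-≡)
open import Data.Empty using (⊥-elim)
import Data.Integer as ℤ
import Data.Integer.Properties as ℤᵖ
open import Data.List using (List; []; _∷_; _++_; map; length; take; filterᵇ; applyUpTo; upTo)
open import Data.List.Properties
  using (++-assoc; ++-identityʳ; length-++; length-map; map-cong; map-∘; map-id-local)
open import Data.List.Membership.Propositional using (_∈_)
open import Data.List.Membership.Propositional.Properties
  using (∈-map⁺; ∈-map⁻; ∈-++⁺ˡ; ∈-++⁺ʳ; ∈-++⁻; ∈-filter⁺; ∈-filter⁻)
open import Data.List.Membership.Propositional.Properties.WithK using (unique∧set⇒bag)
open import Data.List.Relation.Binary.BagAndSetEquality using (∼bag⇒↭)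
open import Data.List.Relation.Binary.Permutation.Propositional.Properties using (↭-length)
open import Data.List.Relation.Unary.All as All using (All; []; _∷_)
import Data.List.Relation.Unary.All.Properties as All
open import Data.List.Relation.Unary.AllPairs using ([]; _∷_)
open import Data.List.Relation.Unary.Any using (here; there)
open import Data.List.Relation.Unary.Any.Properties using (any⁺; any⁻; applyUpTo⁺; applyUpTo⁻)
open import Data.List.Relation.Unary.Unique.Propositional using (Unique)
import Data.List.Relation.Unary.Unique.Propositional.Properties as Unique
open import Data.Nat
  using (ℕ; zero; suc; _+_; _*_; _%_; _≤_; _<_; _≡ᵇ_; _<ᵇ_; NonZero; z≤n; s≤s; z<s; s<s)
open import Data.Nat.DivMod using (m<n⇒m%n≡m; n%n≡0; m%n<n; m%n%n≡m%n; %-distribˡ-+)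
open import Data.Nat.Properties
open import Data.Product using (_×_; _,_; proj₁; proj₂; ∃₂; map₁)
open import Data.Sum using (_⊎_; inj₁; inj₂)
open import Function using (_∘_; id)
open import Function.Bundles using (Equivalence; mk⇔)
open import Relation.Binary.PropositionalEquality
  using (_≡_; _≢_; refl; sym; trans; cong; cong₂; subst; module ≡-Reasoning)
open import Relation.Nullary using (¬_; yes; no)
open import Relation.Nullary.Decidable using (dec-true; dec-false; T?; ⌊_⌋; isYes≗does)

variable
  X Y P : List Step

≡ᵇ-true : ∀ {m n} → m ≡ n → (m ≡ᵇ n) ≡ true
≡ᵇ-true = dec-true (_ ≟ _)

≡ᵇ-false : ∀ {m n} → m ≢ n → (m ≡ᵇ n) ≡ false
≡ᵇ-false = dec-false (_ ≟ _)

<ᵇ-true : ∀ {m n} → m < n → (m <ᵇ n) ≡ true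
<ᵇ-true = dec-true (_ <? _)

<ᵇ-false : ∀ {m n} → ¬ m < n → (m <ᵇ n) ≡ false
<ᵇ-false = dec-false (_ <? _)

+-≡ᵇ : ∀ c m n → (c + m ≡ᵇ c + n) ≡ (m ≡ᵇ n)
+-≡ᵇ zero    m n = refl
+-≡ᵇ (suc c) m n = +-≡ᵇ c m n

+-<ᵇ : ∀ c m n → (c + m <ᵇ c + n) ≡ (m <ᵇ n)
+-<ᵇ zero    m n = refl
+-<ᵇ (suc c) m n = +-<ᵇ c m n

data Split (c : ℕ) : ℕ → Set where
  left  : ∀ {i} → i < c → Split c i
  right : ∀ i → Split c (c + i)

split : ∀ c i → Split c i
split zero    i       = right i
split (suc c) zero    = left z<s
split (suc c) (suc i) with split c i
... | left i<c = left (s<s i<c)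
... | right j  = right j

+-2+ : ∀ a b → a + (2 + b) ≡ 2 + a + b
+-2+ a b = trans (+-suc a (suc b)) (cong suc (+-suc a b))

data LiftPosition (n : ℕ) : ℕ → Set where
  first : LiftPosition n 0
  inner : ∀ {i} → i < n → LiftPosition n (suc i)
  last  : LiftPosition n (suc n)

liftPosition : ∀ {n i} → i < 2 + n → LiftPosition n i
liftPosition {i = zero}  _ = first
liftPosition {i = suc i} (s<s i<) with m<1+n⇒m<n∨m≡n i<
... | inj₁ i<n  = inner i<n
... | inj₂ refl = last

take-++ˡ : ∀ {A : Set} (xs ys : List A) {k} → k ≤ length xs → take k (xs ++ ys) ≡ take k xs
take-++ˡ xs       ys {zero}  _         = refl
take-++ˡ (x ∷ xs) ys {suc k} (s≤s k≤) = cong (x ∷_) (take-++ˡ xs ys k≤)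

take-++ʳ : ∀ {A : Set} (xs ys : List A) k → take (length xs + k) (xs ++ ys) ≡ xs ++ take k ys
take-++ʳ []       ys k = refl
take-++ʳ (x ∷ xs) ys k = cong (x ∷_) (take-++ʳ xs ys k)

filterᵇ-cong : ∀ {A : Set} {f g : A → Bool} xs → (∀ {x} → x ∈ xs → f x ≡ g x) →
               filterᵇ f xs ≡ filterᵇ g xs
filterᵇ-cong []                   eq = refl
filterᵇ-cong {f = f} {g} (x ∷ xs) eq with f x | g x | eq (here refl) | filterᵇ-cong xs (eq ∘ there)
... | true  | true  | refl | same = cong (x ∷_) same
... | false | false | refl | same = same

countBelow : (ℕ → Bool) → ℕ → ℕ
countBelow f zero    = 0
countBelow f (suc m) = (if f 0 then 1 else 0) + countBelow (λ i → f (suc i)) m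

length-filterᵇ-applyUpTo : ∀ {A : Set} (p : A → Bool) h m →
                           length (filterᵇ p (applyUpTo h m)) ≡ countBelow (λ i → p (h i)) m
length-filterᵇ-applyUpTo p h zero = refl
length-filterᵇ-applyUpTo p h (suc m) with p (h 0)
... | true  = cong suc (length-filterᵇ-applyUpTo p (λ i → h (suc i)) m)
... | false = length-filterᵇ-applyUpTo p (λ i → h (suc i)) m

countBelow-+ : ∀ f c m → countBelow f (c + m) ≡ countBelow f c + countBelow (λ i → f (c + i)) m
countBelow-+ f zero    m = refl
countBelow-+ f (suc c) m =
  trans (cong ((if f 0 then 1 else 0) +_) (countBelow-+ (λ i → f (suc i)) c m))
        (sym (+-assoc (if f 0 then 1 else 0) _ _))

countBelow-cong : ∀ {f g} m → (∀ {i} → i < m → f i ≡ g i) → countBelow f m ≡ countBelow g m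
countBelow-cong zero    eq = refl
countBelow-cong (suc m) eq =
  cong₂ (λ b r → (if b then 1 else 0) + r) (eq z<s) (countBelow-cong m (λ i<m → eq (s<s i<m)))

countBelow-false : ∀ {f} m → (∀ {i} → i < m → f i ≡ false) → countBelow f m ≡ 0
countBelow-false zero    none = refl
countBelow-false (suc m) none rewrite none z<s = countBelow-false m (λ i<m → none (s<s i<m))

length-filterᵇ-∘-bijection : ∀ {A : Set} {xs : List A} {r s : A → A} → Unique xs →
  (∀ {x} → x ∈ xs → r x ∈ xs) → (∀ {x} → x ∈ xs → s x ∈ xs) →
  (∀ {x} → x ∈ xs → s (r x) ≡ x) → (∀ {x} → x ∈ xs → r (s x) ≡ x) →
  ∀ f → length (filterᵇ (f ∘ r) xs) ≡ length (filterᵇ f xs)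
length-filterᵇ-∘-bijection {xs = xs} {r} {s} unique r∈ s∈ s∘r r∘s f =
  trans (sym (length-map r ys)) (↭-length (∼bag⇒↭ (unique∧set⇒bag unique-map-r unique-f (mk⇔ to from))))
  where
  ys = filterᵇ (f ∘ r) xs
  s∘r-ys : map s (map r ys) ≡ ys
  s∘r-ys = trans (sym (map-∘ ys)) (map-id-local (All.tabulate (s∘r ∘ proj₁ ∘ ∈-filter⁻ (T? ∘ f ∘ r))))
  unique-map-r : Unique (map r ys)
  unique-map-r = Unique.map⁻ (subst Unique (sym s∘r-ys) (Unique.filter⁺ (T? ∘ f ∘ r) unique))
  unique-f : Unique (filterᵇ f xs)
  unique-f = Unique.filter⁺ (T? ∘ f) unique
  to : ∀ {z} → z ∈ map r ys → z ∈ filterᵇ f xs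
  to z∈ with ∈-map⁻ r z∈
  ... | y , y∈ , refl with ∈-filter⁻ (T? ∘ f ∘ r) y∈
  ...   | y∈xs , fry = ∈-filter⁺ (T? ∘ f) (r∈ y∈xs) fry
  from : ∀ {z} → z ∈ filterᵇ f xs → z ∈ map r ys
  from z∈ with ∈-filter⁻ (T? ∘ f) z∈
  ... | z∈xs , fz = subst (_∈ map r ys) (r∘s z∈xs)
                          (∈-map⁺ r (∈-filter⁺ (T? ∘ f ∘ r) (s∈ z∈xs) (subst (T ∘ f) (sym (r∘s z∈xs)) fz)))

%-suc : ∀ x N .{{_ : NonZero N}} → suc x % N ≡ suc (x % N) % N
%-suc x N = begin
  (1 + x) % N              ≡⟨ %-distribˡ-+ 1 x N ⟩
  (1 % N + x % N) % N      ≡⟨ cong (λ r → (1 % N + r) % N) (sym (m%n%n≡m%n x N)) ⟩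
  (1 % N + x % N % N) % N  ≡⟨ sym (%-distribˡ-+ 1 (x % N) N) ⟩
  (1 + x % N) % N          ∎
  where open ≡-Reasoning

next : (N : ℕ) .{{_ : NonZero N}} → ℕ → ℕ
next N z = suc (z % N)

module _ {N : ℕ} .{{_ : NonZero N}} where

  next-< : ∀ {z} → z < N → next N z ≡ suc z
  next-< z<N = cong suc (m<n⇒m%n≡m z<N)

  next-self : next N N ≡ 1
  next-self = cong suc (n%n≡0 N)

  next-≢1 : ∀ {x} → 0 < x → x < N → next N x ≢ 1
  next-≢1 0<x x<N e = <⇒≢ 0<x (sym (suc-injective (trans (sym (next-< x<N)) e)))

  next-injective : ∀ {x y} → 0 < x → x ≤ N → 0 < y → y ≤ N → next N x ≡ next N y → x ≡ y
  next-injective 0<x x≤N 0<y y≤N eq with m≤n⇒m<n∨m≡n x≤N | m≤n⇒m<n∨m≡n y≤N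
  ... | inj₁ x<N | inj₁ y<N = suc-injective (trans (sym (next-< x<N)) (trans eq (next-< y<N)))
  ... | inj₁ x<N | inj₂ y≡N = ⊥-elim (next-≢1 0<x x<N (trans eq (trans (cong (next N) y≡N) next-self)))
  ... | inj₂ x≡N | inj₁ y<N = ⊥-elim (next-≢1 0<y y<N (trans (sym eq) (trans (cong (next N) x≡N) next-self)))
  ... | inj₂ x≡N | inj₂ y≡N = trans x≡N (sym y≡N)

  next-≡ᵇ : ∀ {x y} → 0 < x → x ≤ N → 0 < y → y ≤ N → (next N x ≡ᵇ next N y) ≡ (x ≡ᵇ y)
  next-≡ᵇ {x} {y} 0<x x≤N 0<y y≤N with x ≟ y
  ... | yes refl = trans (≡ᵇ-true {next N x} refl) (sym (≡ᵇ-true {x} refl))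
  ... | no x≢y   = trans (≡ᵇ-false (x≢y ∘ next-injective 0<x x≤N 0<y y≤N)) (sym (≡ᵇ-false x≢y))

data Balanced : List Step → Set where
  nil  : Balanced []
  join : Balanced X → Balanced Y → Balanced (U ∷ X ++ D ∷ Y)

lift : List Step → List Step
lift X = U ∷ X ++ D ∷ []

join≡lift-++ : ∀ X Y → U ∷ X ++ D ∷ Y ≡ lift X ++ Y
join≡lift-++ X Y = cong (U ∷_) (sym (++-assoc X (D ∷ []) Y))

length-lift : ∀ X → length (lift X) ≡ 2 + length X
length-lift X = cong suc (trans (length-++ X) (+-comm (length X) 1))

Balanced-lift : Balanced X → Balanced (lift X)
Balanced-lift bx = join bx nil

Balanced-++ : Balanced X → Balanced Y → Balanced (X ++ Y)
Balanced-++ nil by = by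
Balanced-++ {Y = Y} (join {X₁} {Y₁} b₁ b₂) by
  rewrite ++-assoc X₁ (D ∷ Y₁) Y = join b₁ (Balanced-++ b₂ by)

dyckFrom-++ : Balanced X → ∀ h w → dyckFrom h (X ++ w) ≡ dyckFrom h w
dyckFrom-++ nil h w = refl
dyckFrom-++ (join {X₁} {Y₁} b₁ b₂) h w
  rewrite ++-assoc X₁ (D ∷ Y₁) w | dyckFrom-++ b₁ (suc h) (D ∷ Y₁ ++ w) = dyckFrom-++ b₂ h w

Balanced⇒isDyck : Balanced X → isDyck X ≡ true
Balanced⇒isDyck {X = X} bx = trans (cong isDyck (sym (++-identityʳ X))) (dyckFrom-++ bx 0 [])

-- w = B₀ D B₁ D ⋯ D B_h with every Bᵢ balanced
Closes : ℕ → List Step → Set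
Closes zero    w = Balanced w
Closes (suc h) w = ∃₂ λ X Y → Balanced X × w ≡ X ++ D ∷ Y × Closes h Y

Closes-join : ∀ h → Balanced X → Closes h Y → Closes h (U ∷ X ++ D ∷ Y)
Closes-join zero    bx by = join bx by
Closes-join {X = X} (suc h) bx (X′ , Y′ , bx′ , refl , cy′) =
  U ∷ X ++ D ∷ X′ , Y′ , join bx bx′ , cong (U ∷_) (sym (++-assoc X (D ∷ X′) (D ∷ Y′))) , cy′

dyckFrom⇒Closes : ∀ h w → dyckFrom h w ≡ true → Closes h w
dyckFrom⇒Closes zero    []      _ = nil
dyckFrom⇒Closes h       (U ∷ w) d with dyckFrom⇒Closes (suc h) w d
... | X , Y , bx , refl , cy = Closes-join h bx cy
dyckFrom⇒Closes (suc h) (D ∷ w) d = [] , w , nil , refl , dyckFrom⇒Closes h w d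

isDyck⇒Balanced : isDyck X ≡ true → Balanced X
isDyck⇒Balanced = dyckFrom⇒Closes 0 _

heightAll-++ : ∀ X Y → heightAll (X ++ Y) ≡ heightAll X ℤ.+ heightAll Y
heightAll-++ []      Y = sym (ℤᵖ.+-identityˡ _)
heightAll-++ (s ∷ X) Y
  rewrite heightAll-++ X Y = sym (ℤᵖ.+-assoc (stepVal s) (heightAll X) (heightAll Y))

heightAll-Balanced : Balanced X → heightAll X ≡ ℤ.+ 0
heightAll-Balanced nil = refl
heightAll-Balanced (join {X} {Y} bx by)
  rewrite heightAll-++ X (D ∷ Y) | heightAll-Balanced bx | heightAll-Balanced by = refl

height-++ˡ : ∀ {k} → k ≤ length X → height k (X ++ Y) ≡ height k X
height-++ˡ {X = X} {Y = Y} k≤ = cong heightAll (take-++ˡ X Y k≤)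

height-++ʳ : Balanced X → ∀ k → height (length X + k) (X ++ Y) ≡ height k Y
height-++ʳ {X = X} {Y = Y} bx k = begin
  heightAll (take (length X + k) (X ++ Y))  ≡⟨ cong heightAll (take-++ʳ X Y k) ⟩
  heightAll (X ++ take k Y)                 ≡⟨ heightAll-++ X (take k Y) ⟩
  heightAll X ℤ.+ height k Y                ≡⟨ cong (ℤ._+ height k Y) (heightAll-Balanced bx) ⟩
  ℤ.+ 0 ℤ.+ height k Y                      ≡⟨ ℤᵖ.+-identityˡ _ ⟩
  height k Y                                ∎
  where open ≡-Reasoning

height-lift : ∀ {k} → k ≤ length X → height (suc k) (lift X) ≡ ℤ.suc (height k X)
height-lift {X = X} k≤ = cong (λ w → ℤ.suc (heightAll w)) (take-++ˡ X (D ∷ []) k≤)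

shiftArc : ℕ → ℕ × ℕ → ℕ × ℕ
shiftArc c (j , i) = c + j , c + i

length-join : ∀ X Y → length (U ∷ X ++ D ∷ Y) ≡ 2 + length X + length Y
length-join X Y = begin
  length (U ∷ X ++ D ∷ Y)       ≡⟨ cong length (join≡lift-++ X Y) ⟩
  length (lift X ++ Y)          ≡⟨ length-++ (lift X) ⟩
  length (lift X) + length Y    ≡⟨ cong (_+ length Y) (length-lift X) ⟩
  2 + length X + length Y       ∎
  where open ≡-Reasoning

-- the stack left over from before X is untouched while the balanced prefix X is read
matchFrom-++ : Balanced X → ∀ i st w →
               matchFrom i st (X ++ w) ≡ matchFrom i [] X ++ matchFrom (i + length X) st w
matchFrom-++ nil i st w rewrite +-identityʳ i = refl
matchFrom-++ (join {X₁} {Y₁} b₁ b₂) i st w = begin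
  matchFrom (suc i) (i ∷ st) ((X₁ ++ D ∷ Y₁) ++ w)
    ≡⟨ cong (matchFrom (suc i) (i ∷ st)) (++-assoc X₁ (D ∷ Y₁) w) ⟩
  matchFrom (suc i) (i ∷ st) (X₁ ++ D ∷ Y₁ ++ w)
    ≡⟨ matchFrom-++ b₁ (suc i) (i ∷ st) (D ∷ Y₁ ++ w) ⟩
  M₁ ++ arc ∷ matchFrom j st (Y₁ ++ w)
    ≡⟨ cong (λ ms → M₁ ++ arc ∷ ms) (matchFrom-++ b₂ j st w) ⟩
  M₁ ++ arc ∷ matchFrom j [] Y₁ ++ matchFrom (j + length Y₁) st w
    ≡⟨ sym (++-assoc M₁ (arc ∷ matchFrom j [] Y₁) _) ⟩
  (M₁ ++ arc ∷ matchFrom j [] Y₁) ++ matchFrom (j + length Y₁) st w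
    ≡⟨ cong₂ _++_ (sym (matchFrom-++ b₁ (suc i) (i ∷ []) (D ∷ Y₁)))
                  (cong (λ e → matchFrom e st w) (sym end)) ⟩
  matchFrom (suc i) (i ∷ []) (X₁ ++ D ∷ Y₁) ++ matchFrom (i + length (U ∷ X₁ ++ D ∷ Y₁)) st w ∎
  where
  open ≡-Reasoning
  M₁ = matchFrom (suc i) [] X₁
  arc = i , suc i + length X₁
  j = suc (suc i + length X₁)
  end : i + length (U ∷ X₁ ++ D ∷ Y₁) ≡ j + length Y₁
  end = trans (cong (i +_) (length-join X₁ Y₁))
              (trans (+-2+ i _) (cong (2 +_) (sym (+-assoc i (length X₁) (length Y₁)))))

matchFrom-shift : ∀ c i st w →
                  matchFrom (c + i) (map (c +_) st) w ≡ map (shiftArc c) (matchFrom i st w)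
matchFrom-shift c i st [] = refl
matchFrom-shift c i st (U ∷ w) rewrite sym (+-suc c i) = matchFrom-shift c (suc i) (i ∷ st) w
matchFrom-shift c i [] (D ∷ w) rewrite sym (+-suc c i) = matchFrom-shift c (suc i) [] w
matchFrom-shift c i (j ∷ st) (D ∷ w) rewrite sym (+-suc c i) =
  cong ((c + j , c + i) ∷_) (matchFrom-shift c (suc i) st w)

matchFrom-suc : ∀ c w → matchFrom (suc c) [] w ≡ map (shiftArc c) (matching w)
matchFrom-suc c w = trans (cong (λ i → matchFrom i [] w) (sym (+-comm c 1))) (matchFrom-shift c 1 [] w)

matching-++ : Balanced X → ∀ Y → matching (X ++ Y) ≡ matching X ++ map (shiftArc (length X)) (matching Y)
matching-++ {X = X} bx Y = trans (matchFrom-++ bx 1 [] Y) (cong (matching X ++_) (matchFrom-suc (length X) Y))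

matching-lift : Balanced X → matching (lift X) ≡ map (shiftArc 1) (matching X) ++ (1 , 2 + length X) ∷ []
matching-lift {X = X} bx =
  trans (matchFrom-++ bx 2 (1 ∷ []) (D ∷ [])) (cong (_++ (1 , 2 + length X) ∷ []) (matchFrom-suc 1 X))

Within : ℕ → ℕ → ℕ → Set
Within lo hi z = lo ≤ z × z < hi

ArcsWithin : ℕ → ℕ → List (ℕ × ℕ) → Set
ArcsWithin lo hi = All λ (j , i) → Within lo hi j × Within lo hi i

Within-suc : ∀ {lo hi z} → Within lo hi z → Within lo (suc hi) z
Within-suc (lo≤z , z<hi) = lo≤z , m≤n⇒m≤1+n z<hi

module _ {lo hi : ℕ} where

  lookupPartner-outside-++ : ∀ {L} M z → ArcsWithin lo hi L → ¬ Within lo hi z →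
                             lookupPartner (L ++ M) z ≡ lookupPartner M z
  lookupPartner-outside-++ M z [] out = refl
  lookupPartner-outside-++ {(j , i) ∷ L} M z ((wj , wi) ∷ ws) out
    rewrite ≡ᵇ-false {j} {z} (λ { refl → out wj }) | ≡ᵇ-false {i} {z} (λ { refl → out wi }) =
    lookupPartner-outside-++ {L} M z ws out

  lookupPartner-within : ∀ {L} z → ArcsWithin lo hi L → lookupPartner L z ≡ 0 ⊎ Within lo hi (lookupPartner L z)
  lookupPartner-within z [] = inj₁ refl
  lookupPartner-within {(j , i) ∷ L} z ((wj , wi) ∷ ws) with j ≡ᵇ z
  ... | true = inj₂ wi
  ... | false with i ≡ᵇ z
  ...   | true  = inj₂ wj
  ...   | false = lookupPartner-within z ws

lookupPartner-inside-++ : ∀ L M z → lookupPartner L z ≢ 0 → lookupPartner (L ++ M) z ≡ lookupPartner L z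
lookupPartner-inside-++ []            M z p = ⊥-elim (p refl)
lookupPartner-inside-++ ((j , i) ∷ L) M z p with j ≡ᵇ z
... | true = refl
... | false with i ≡ᵇ z
...   | true  = refl
...   | false = lookupPartner-inside-++ L M z p

-- shifts a partner position, keeping 0 ("no partner") fixed
shift₀ : ℕ → ℕ → ℕ
shift₀ c zero    = zero
shift₀ c (suc v) = c + suc v

lookupPartner-shift : ∀ {hi L} c z → ArcsWithin 1 hi L →
                      lookupPartner (map (shiftArc c) L) (c + z) ≡ shift₀ c (lookupPartner L z)
lookupPartner-shift c z [] = refl
lookupPartner-shift {L = (suc j , suc i) ∷ L} c z (_ ∷ ws)
  rewrite +-≡ᵇ c (suc j) z | +-≡ᵇ c (suc i) z with suc j ≡ᵇ z
... | true = refl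
... | false with suc i ≡ᵇ z
...   | true  = refl
...   | false = lookupPartner-shift c z ws

matchFrom-within : ∀ i st w → 1 ≤ i → All (Within 1 i) st → ArcsWithin 1 (i + length w) (matchFrom i st w)
matchFrom-within i st       []      _   _ = []
matchFrom-within i st       (U ∷ w) 1≤i ws rewrite +-suc i (length w) =
  matchFrom-within (suc i) (i ∷ st) w (m≤n⇒m≤1+n 1≤i) ((1≤i , ≤-refl) ∷ All.map Within-suc ws)
matchFrom-within i []       (D ∷ w) 1≤i [] rewrite +-suc i (length w) =
  matchFrom-within (suc i) [] w (m≤n⇒m≤1+n 1≤i) []
matchFrom-within i (j ∷ st) (D ∷ w) 1≤i ((1≤j , j<i) ∷ ws) rewrite +-suc i (length w) =
  ((1≤j , <-≤-trans j<i (m≤n⇒m≤1+n (m≤m+n i (length w)))) , (1≤i , s≤s (m≤m+n i (length w))))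
  ∷ matchFrom-within (suc i) st w (m≤n⇒m≤1+n 1≤i) (All.map Within-suc ws)

matching-within : ∀ w → ArcsWithin 1 (suc (length w)) (matching w)
matching-within w = matchFrom-within 1 [] w ≤-refl []

ArcsWithin-shift : ∀ {lo hi L} c → ArcsWithin lo hi L → ArcsWithin (c + lo) (c + hi) (map (shiftArc c) L)
ArcsWithin-shift c ws = All.map⁺ (All.map (λ (wj , wi) → shiftWithin wj , shiftWithin wi) ws)
  where shiftWithin : ∀ {lo hi z} → Within lo hi z → Within (c + lo) (c + hi) (c + z)
        shiftWithin (lo≤z , z<hi) = +-monoʳ-≤ c lo≤z , +-monoʳ-< c z<hi

shift₀-≢0 : ∀ {c v} → v ≢ 0 → shift₀ c v ≢ 0
shift₀-≢0 {c} {zero}  p = ⊥-elim (p refl)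
shift₀-≢0 {c} {suc v} _ q = 1+n≢0 (trans (sym (+-suc c v)) q)

shift₀-suc : ∀ c {v} → v ≢ 0 → shift₀ c v ≡ c + v
shift₀-suc c {zero}  p = ⊥-elim (p refl)
shift₀-suc c {suc v} _ = refl

tunnel-++ˡ₀ : Balanced X → ∀ Y z → tunnel X z ≢ 0 → tunnel (X ++ Y) z ≡ tunnel X z
tunnel-++ˡ₀ {X = X} bx Y z p rewrite matching-++ bx Y = lookupPartner-inside-++ (matching X) _ z p

tunnel-++ʳ₀ : Balanced X → ∀ Y i → tunnel (X ++ Y) (suc (length X + i)) ≡ shift₀ (length X) (tunnel Y (suc i))
tunnel-++ʳ₀ {X = X} bx Y i rewrite matching-++ bx Y | sym (+-suc (length X) i) =
  trans (lookupPartner-outside-++ _ _ (matching-within X) beyond)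
        (lookupPartner-shift (length X) (suc i) (matching-within Y))
  where beyond : ¬ Within 1 (suc (length X)) (length X + suc i)
        beyond (_ , lt) = <⇒≱ (m<m+n (length X) z<s) (≤-pred lt)

tunnel-lift-first : Balanced X → tunnel (lift X) 1 ≡ 2 + length X
tunnel-lift-first {X = X} bx rewrite matching-lift bx =
  lookupPartner-outside-++ _ 1 (ArcsWithin-shift 1 (matching-within X)) λ { (s≤s () , _) }

tunnel-lift-last : Balanced X → tunnel (lift X) (2 + length X) ≡ 1
tunnel-lift-last {X = X} bx rewrite matching-lift bx
  | lookupPartner-outside-++ ((1 , 2 + length X) ∷ []) (2 + length X)
      (ArcsWithin-shift 1 (matching-within X)) (λ (_ , lt) → n≮n _ lt)
  | ≡ᵇ-true {2 + length X} refl = refl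

tunnel-lift-inner₀ : Balanced X → ∀ z → tunnel X z ≢ 0 → tunnel (lift X) (suc z) ≡ suc (tunnel X z)
tunnel-lift-inner₀ {X = X} bx z p rewrite matching-lift bx =
  trans (lookupPartner-inside-++ (map (shiftArc 1) (matching X)) _ (suc z) (1+n≢0 ∘ trans (sym shifted)))
        shifted
  where shifted : lookupPartner (map (shiftArc 1) (matching X)) (suc z) ≡ suc (tunnel X z)
        shifted = trans (lookupPartner-shift 1 z (matching-within X)) (shift₀-suc 1 p)

tunnel-lift-≢0 : Balanced X → (∀ i → i < length X → tunnel X (suc i) ≢ 0) →
                 ∀ i → i < 2 + length X → tunnel (lift X) (suc i) ≢ 0
tunnel-lift-≢0 bx inside i i< with liftPosition i<
... | first rewrite tunnel-lift-first bx = λ ()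
... | inner {j} j< rewrite tunnel-lift-inner₀ bx (suc j) (inside j j<) = λ ()
... | last rewrite tunnel-lift-last bx = λ ()

tunnel-≢0 : Balanced P → ∀ i → i < length P → tunnel P (suc i) ≢ 0
tunnel-≢0 (join {X} {Y} bx by) i i< =
  subst (λ P → tunnel P (suc i) ≢ 0) (sym (join≡lift-++ X Y))
        (lift-++ i (subst (i <_) (trans (cong length (join≡lift-++ X Y)) (length-++ (lift X))) i<))
  where
  lift-++ : ∀ i → i < length (lift X) + length Y → tunnel (lift X ++ Y) (suc i) ≢ 0
  lift-++ i i< with split (length (lift X)) i
  ... | left i<c = λ q → inLift (trans (sym (tunnel-++ˡ₀ (Balanced-lift bx) Y (suc i) inLift)) q)
    where inLift = tunnel-lift-≢0 bx (tunnel-≢0 bx) i (subst (i <_) (length-lift X) i<c)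
  ... | right j rewrite tunnel-++ʳ₀ (Balanced-lift bx) Y j =
    shift₀-≢0 (tunnel-≢0 by j (+-cancelˡ-< (length (lift X)) j (length Y) i<))

tunnel-++ˡ : Balanced X → ∀ Y {i} → i < length X → tunnel (X ++ Y) (suc i) ≡ tunnel X (suc i)
tunnel-++ˡ bx Y {i} i< = tunnel-++ˡ₀ bx Y (suc i) (tunnel-≢0 bx i i<)

tunnel-++ʳ : Balanced X → Balanced Y → ∀ {i} → i < length Y →
             tunnel (X ++ Y) (suc (length X + i)) ≡ length X + tunnel Y (suc i)
tunnel-++ʳ bx by {i} i< = trans (tunnel-++ʳ₀ bx _ i) (shift₀-suc _ (tunnel-≢0 by i i<))

tunnel-lift-inner : Balanced X → ∀ {i} → i < length X → tunnel (lift X) (suc (suc i)) ≡ suc (tunnel X (suc i))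
tunnel-lift-inner bx {i} i< = tunnel-lift-inner₀ bx (suc i) (tunnel-≢0 bx i i<)

tunnel-≤-length : ∀ P z → tunnel P z ≤ length P
tunnel-≤-length P z with lookupPartner-within z (matching-within P)
... | inj₁ none       = subst (_≤ length P) (sym none) z≤n
... | inj₂ (_ , v<)   = ≤-pred v<

tunnel-positive : Balanced P → ∀ {i} → i < length P → 0 < tunnel P (suc i)
tunnel-positive bp {i} i< = n≢0⇒n>0 (tunnel-≢0 bp i i<)

-- steps among the first k paired beyond k: these are the up-steps still open after step k
crossings : List Step → ℕ → ℕ
crossings P k = countBelow (λ i → k <ᵇ tunnel P (suc i)) k

crossings-++ˡ : Balanced X → ∀ Y {k} → k ≤ length X → crossings (X ++ Y) k ≡ crossings X k
crossings-++ˡ bx Y {k} k≤ = countBelow-cong k (λ i<k → cong (k <ᵇ_) (tunnel-++ˡ bx Y (<-≤-trans i<k k≤)))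

crossings-++ʳ : Balanced X → Balanced Y → ∀ {k} → k ≤ length Y →
                crossings (X ++ Y) (length X + k) ≡ crossings Y k
crossings-++ʳ {X = X} {Y = Y} bx by {k} k≤ =
  trans (countBelow-+ _ (length X) k) (cong₂ _+_ noneInX (countBelow-cong k inY))
  where
  noneInX : countBelow (λ i → length X + k <ᵇ tunnel (X ++ Y) (suc i)) (length X) ≡ 0
  noneInX = countBelow-false (length X) λ {i} i< → <ᵇ-false λ lt →
    <⇒≱ lt (subst (_≤ length X + k) (sym (tunnel-++ˡ bx Y i<)) (≤-trans (tunnel-≤-length X _) (m≤m+n _ k)))
  inY : ∀ {i} → i < k → (length X + k <ᵇ tunnel (X ++ Y) (suc (length X + i))) ≡ (k <ᵇ tunnel Y (suc i))
  inY i<k = trans (cong (length X + k <ᵇ_) (tunnel-++ʳ bx by (<-≤-trans i<k k≤))) (+-<ᵇ (length X) k _)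

crossings-lift : Balanced X → ∀ {k} → k ≤ length X → crossings (lift X) (suc k) ≡ suc (crossings X k)
crossings-lift {X = X} bx {k} k≤ rewrite tunnel-lift-first bx | <ᵇ-true (s≤s k≤) =
  cong suc (countBelow-cong k (λ i<k → cong (suc k <ᵇ_) (tunnel-lift-inner bx (<-≤-trans i<k k≤))))

crossings≡height : Balanced P → ∀ k → k ≤ length P → ℤ.+ crossings P k ≡ height k P
crossings≡height nil zero _ = refl
crossings≡height (join {X} {Y} bx by) k k≤ =
  subst (λ P → ℤ.+ crossings P k ≡ height k P) (sym (join≡lift-++ X Y))
        (lift-++ k (subst (k ≤_) (trans (cong length (join≡lift-++ X Y)) (length-++ (lift X))) k≤))
  where
  open ≡-Reasoning
  inLift : ∀ k → k < 2 + length X → ℤ.+ crossings (lift X) k ≡ height k (lift X)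
  inLift zero    _        = refl
  inLift (suc k) (s<s k<) = begin
    ℤ.+ crossings (lift X) (suc k)  ≡⟨ cong ℤ.+_ (crossings-lift bx (≤-pred k<)) ⟩
    ℤ.suc (ℤ.+ crossings X k)       ≡⟨ cong ℤ.suc (crossings≡height bx k (≤-pred k<)) ⟩
    ℤ.suc (height k X)              ≡⟨ sym (height-lift (≤-pred k<)) ⟩
    height (suc k) (lift X)         ∎
  lift-++ : ∀ k → k ≤ length (lift X) + length Y → ℤ.+ crossings (lift X ++ Y) k ≡ height k (lift X ++ Y)
  lift-++ k k≤ with split (length (lift X)) k
  ... | left k<c = begin
    ℤ.+ crossings (lift X ++ Y) k  ≡⟨ cong ℤ.+_ (crossings-++ˡ (Balanced-lift bx) Y (<⇒≤ k<c)) ⟩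
    ℤ.+ crossings (lift X) k       ≡⟨ inLift k (subst (k <_) (length-lift X) k<c) ⟩
    height k (lift X)              ≡⟨ sym (height-++ˡ (<⇒≤ k<c)) ⟩
    height k (lift X ++ Y)         ∎
  ... | right j = begin
    ℤ.+ crossings (lift X ++ Y) (length (lift X) + j)  ≡⟨ cong ℤ.+_ (crossings-++ʳ (Balanced-lift bx) by j≤) ⟩
    ℤ.+ crossings Y j                                  ≡⟨ crossings≡height by j j≤ ⟩
    height j Y                                         ≡⟨ sym (height-++ʳ (Balanced-lift bx) j) ⟩
    height (length (lift X) + j) (lift X ++ Y)         ∎
    where j≤ = +-cancelˡ-≤ (length (lift X)) j (length Y) k≤

-- splitAtReturn h w = (X , Y) where w = X ++ D ∷ Y and that D is the first step taking w below height -h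
splitAtReturn : ℕ → List Step → List Step × List Step
splitAtReturn h       []      = [] , []
splitAtReturn h       (U ∷ w) = map₁ (U ∷_) (splitAtReturn (suc h) w)
splitAtReturn zero    (D ∷ w) = [] , w
splitAtReturn (suc h) (D ∷ w) = map₁ (D ∷_) (splitAtReturn h w)

rotate : List Step → List Step
rotate []      = []
rotate (U ∷ w) = proj₁ s ++ lift (proj₂ s) where s = splitAtReturn 0 w
rotate (D ∷ w) = D ∷ w

splitAtReturn-++ : Balanced X → ∀ h w → splitAtReturn h (X ++ w) ≡ map₁ (X ++_) (splitAtReturn h w)
splitAtReturn-++ nil h w = refl
splitAtReturn-++ (join {X₁} {Y₁} b₁ b₂) h w
  rewrite ++-assoc X₁ (D ∷ Y₁) w | splitAtReturn-++ b₁ (suc h) (D ∷ Y₁ ++ w) | splitAtReturn-++ b₂ h w =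
  cong (λ xs → U ∷ xs , proj₂ (splitAtReturn h w)) (sym (++-assoc X₁ (D ∷ Y₁) _))

rotate-join : Balanced X → ∀ Y → rotate (U ∷ X ++ D ∷ Y) ≡ X ++ lift Y
rotate-join {X = X} bx Y rewrite splitAtReturn-++ bx 0 (D ∷ Y) = cong (_++ lift Y) (++-identityʳ X)

length-rotate : Balanced P → length (rotate P) ≡ length P
length-rotate nil = refl
length-rotate (join {X} {Y} bx by) = begin
  length (rotate (U ∷ X ++ D ∷ Y))  ≡⟨ cong length (rotate-join bx Y) ⟩
  length (X ++ lift Y)              ≡⟨ length-++ X ⟩
  length X + length (lift Y)        ≡⟨ cong (length X +_) (length-lift Y) ⟩
  length X + (2 + length Y)         ≡⟨ +-2+ (length X) (length Y) ⟩
  2 + length X + length Y           ≡⟨ sym (length-join X Y) ⟩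
  length (U ∷ X ++ D ∷ Y)           ∎
  where open ≡-Reasoning

Balanced-rotate : Balanced P → Balanced (rotate P)
Balanced-rotate nil = nil
Balanced-rotate (join {X} {Y} bx by) = subst Balanced (sym (rotate-join bx Y)) (Balanced-++ bx (Balanced-lift by))

tunnel-rotate-join : ∀ {N} .{{_ : NonZero N}} → Balanced X → Balanced Y → 2 + length X + length Y ≡ N →
                     ∀ {i} → i < N → tunnel (lift X ++ Y) (next N (suc i)) ≡ next N (tunnel (X ++ lift Y) (suc i))
tunnel-rotate-join {X = X} {Y = Y} {N = N} bx by eN {i} i<N = cases (split p i) i<N
  where
  open ≡-Reasoning
  p = length X
  q = length Y
  τ = tunnel (lift X ++ Y)
  ρ = tunnel (X ++ lift Y)
  bX⁺ = Balanced-lift bx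
  bY⁺ = Balanced-lift by
  p+2+q≡N : p + (2 + q) ≡ N
  p+2+q≡N = trans (+-2+ p q) eN
  next-suc : ∀ {z} → z ≤ suc (p + q) → next N z ≡ suc z
  next-suc {z} z≤ = next-< (subst (z <_) eN (s≤s z≤))
  inLift : ∀ W {z} → z < 2 + length W → z < length (lift W)
  inLift W {z} = subst (z <_) (sym (length-lift W))
  cases : ∀ {i} → Split p i → i < N → τ (next N (suc i)) ≡ next N (ρ (suc i))
  cases (left {i} i<p) _ = begin
    τ (next N (suc i))              ≡⟨ cong τ (next-suc (s≤s (≤-trans (<⇒≤ i<p) (m≤m+n p q)))) ⟩
    τ (suc (suc i))                 ≡⟨ tunnel-++ˡ bX⁺ Y (inLift X (s<s (m<n⇒m<1+n i<p))) ⟩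
    tunnel (lift X) (suc (suc i))   ≡⟨ tunnel-lift-inner bx i<p ⟩
    suc (tunnel X (suc i))          ≡⟨ sym (next-suc τX≤) ⟩
    next N (tunnel X (suc i))       ≡⟨ cong (next N) (sym (tunnel-++ˡ bx (lift Y) i<p)) ⟩
    next N (ρ (suc i))              ∎
    where τX≤ = m≤n⇒m≤1+n (≤-trans (tunnel-≤-length X _) (m≤m+n p q))
  cases (right j) p+j<N with liftPosition {q} (+-cancelˡ-< p j (2 + q) (subst (p + j <_) (sym p+2+q≡N) p+j<N))
  ... | first = begin
    τ (next N (suc (p + 0)))        ≡⟨ cong τ (next-suc (s≤s (+-monoʳ-≤ p z≤n))) ⟩
    τ (suc (suc (p + 0)))           ≡⟨ tunnel-++ˡ bX⁺ Y (inLift X (s<s (s<s (≤-reflexive (+-identityʳ p))))) ⟩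
    tunnel (lift X) (2 + (p + 0))   ≡⟨ cong (λ z → tunnel (lift X) (2 + z)) (+-identityʳ p) ⟩
    tunnel (lift X) (2 + p)         ≡⟨ tunnel-lift-last bx ⟩
    1                               ≡⟨ sym next-self ⟩
    next N N                        ≡⟨ cong (next N) (sym p+2+q≡N) ⟩
    next N (p + (2 + q))            ≡⟨ cong (λ z → next N (p + z)) (sym (tunnel-lift-first by)) ⟩
    next N (p + tunnel (lift Y) 1)  ≡⟨ cong (next N) (sym (tunnel-++ʳ bx bY⁺ (inLift Y z<s))) ⟩
    next N (ρ (suc (p + 0)))        ∎
  ... | inner {k} k<q = begin
    τ (next N (suc (p + suc k)))                ≡⟨ cong τ (next-suc (s≤s (+-monoʳ-≤ p k<q))) ⟩
    τ (suc (suc (p + suc k)))                   ≡⟨ cong (τ ∘ suc) shuffle ⟩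
    τ (suc (length (lift X) + k))               ≡⟨ tunnel-++ʳ bX⁺ by k<q ⟩
    length (lift X) + tunnel Y (suc k)          ≡⟨ cong (_+ tunnel Y (suc k)) (length-lift X) ⟩
    2 + p + tunnel Y (suc k)                    ≡⟨ cong suc (sym (+-suc p _)) ⟩
    suc (p + suc (tunnel Y (suc k)))            ≡⟨ sym (next-suc p+τY≤) ⟩
    next N (p + suc (tunnel Y (suc k)))         ≡⟨ cong (λ z → next N (p + z)) (sym (tunnel-lift-inner by k<q)) ⟩
    next N (p + tunnel (lift Y) (suc (suc k)))  ≡⟨ cong (next N) (sym (tunnel-++ʳ bx bY⁺ (inLift Y (s<s (m<n⇒m<1+n k<q))))) ⟩
    next N (ρ (suc (p + suc k)))                ∎
    where
    shuffle : suc (p + suc k) ≡ length (lift X) + k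
    shuffle = trans (cong suc (+-suc p k)) (cong (_+ k) (sym (length-lift X)))
    p+τY≤ : p + suc (tunnel Y (suc k)) ≤ suc (p + q)
    p+τY≤ = subst (_≤ suc (p + q)) (sym (+-suc p _)) (s≤s (+-monoʳ-≤ p (tunnel-≤-length Y _)))
  ... | last = begin
    τ (next N (suc (p + suc q)))          ≡⟨ cong (τ ∘ next N) (trans (sym (+-suc p (suc q))) p+2+q≡N) ⟩
    τ (next N N)                          ≡⟨ cong τ next-self ⟩
    τ 1                                   ≡⟨ tunnel-++ˡ bX⁺ Y (inLift X z<s) ⟩
    tunnel (lift X) 1                     ≡⟨ tunnel-lift-first bx ⟩
    2 + p                                 ≡⟨ cong suc (+-comm 1 p) ⟩
    suc (p + 1)                           ≡⟨ sym (next-suc (subst (p + 1 ≤_) (+-suc p q) (+-monoʳ-≤ p (s≤s z≤n)))) ⟩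
    next N (p + 1)                        ≡⟨ cong (λ z → next N (p + z)) (sym (tunnel-lift-last by)) ⟩
    next N (p + tunnel (lift Y) (2 + q))  ≡⟨ cong (next N) (sym (tunnel-++ʳ bx bY⁺ (inLift Y ≤-refl))) ⟩
    next N (ρ (suc (p + suc q)))          ∎

tunnel-rotate : Balanced P → ∀ {N} .{{_ : NonZero N}} → length P ≡ N → ∀ {i} → i < N →
                tunnel P (next N (suc i)) ≡ next N (tunnel (rotate P) (suc i))
tunnel-rotate nil refl ()
tunnel-rotate (join {X} {Y} bx by) {N} eN {i} i<N =
  trans (cong (λ Q → tunnel Q (next N (suc i))) (join≡lift-++ X Y))
        (trans (tunnel-rotate-join bx by (trans (sym (length-join X Y)) eN) i<N)
               (cong (λ R → next N (tunnel R (suc i))) (sym (rotate-join bx Y))))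

flipStep : Step → Step
flipStep U = D
flipStep D = U

mirror : List Step → List Step
mirror []      = []
mirror (s ∷ w) = mirror w ++ flipStep s ∷ []

mirror-++ : ∀ X Y → mirror (X ++ Y) ≡ mirror Y ++ mirror X
mirror-++ []      Y = sym (++-identityʳ (mirror Y))
mirror-++ (s ∷ X) Y rewrite mirror-++ X Y = ++-assoc (mirror Y) (mirror X) _

mirror-involutive : ∀ w → mirror (mirror w) ≡ w
mirror-involutive []      = refl
mirror-involutive (U ∷ w) rewrite mirror-++ (mirror w) (D ∷ []) | mirror-involutive w = refl
mirror-involutive (D ∷ w) rewrite mirror-++ (mirror w) (U ∷ []) | mirror-involutive w = refl

length-mirror : ∀ w → length (mirror w) ≡ length w
length-mirror []      = refl
length-mirror (s ∷ w) rewrite length-++ (mirror w) {flipStep s ∷ []} | length-mirror w = +-comm (length w) 1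

mirror-lift : ∀ X → mirror (lift X) ≡ lift (mirror X)
mirror-lift X = cong (_++ D ∷ []) (mirror-++ X (D ∷ []))

mirror-join : ∀ X Y → mirror (U ∷ X ++ D ∷ Y) ≡ mirror Y ++ lift (mirror X)
mirror-join X Y = begin
  mirror (U ∷ X ++ D ∷ Y)        ≡⟨ cong mirror (join≡lift-++ X Y) ⟩
  mirror (lift X ++ Y)           ≡⟨ mirror-++ (lift X) Y ⟩
  mirror Y ++ mirror (lift X)    ≡⟨ cong (mirror Y ++_) (mirror-lift X) ⟩
  mirror Y ++ lift (mirror X)    ∎
  where open ≡-Reasoning

Balanced-mirror : Balanced X → Balanced (mirror X)
Balanced-mirror nil = nil
Balanced-mirror (join {X} {Y} bx by) =
  subst Balanced (sym (mirror-join X Y)) (Balanced-++ (Balanced-mirror by) (Balanced-lift (Balanced-mirror bx)))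

rotate-mirror-rotate : Balanced P → rotate (mirror (rotate P)) ≡ mirror P
rotate-mirror-rotate nil = refl
rotate-mirror-rotate (join {X} {Y} bx by) = begin
  rotate (mirror (rotate (U ∷ X ++ D ∷ Y)))  ≡⟨ cong (rotate ∘ mirror) (rotate-join bx Y) ⟩
  rotate (mirror (X ++ lift Y))              ≡⟨ cong rotate (mirror-++ X (lift Y)) ⟩
  rotate (mirror (lift Y) ++ mirror X)       ≡⟨ cong (λ w → rotate (w ++ mirror X)) (mirror-lift Y) ⟩
  rotate (lift (mirror Y) ++ mirror X)       ≡⟨ cong rotate (sym (join≡lift-++ (mirror Y) (mirror X))) ⟩
  rotate (U ∷ mirror Y ++ D ∷ mirror X)      ≡⟨ rotate-join (Balanced-mirror by) (mirror X) ⟩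
  mirror Y ++ lift (mirror X)                ≡⟨ sym (mirror-join X Y) ⟩
  mirror (U ∷ X ++ D ∷ Y)                    ∎
  where open ≡-Reasoning

unrotate : List Step → List Step
unrotate = mirror ∘ rotate ∘ mirror

unrotate-rotate : Balanced P → unrotate (rotate P) ≡ P
unrotate-rotate {P} bp = trans (cong mirror (rotate-mirror-rotate bp)) (mirror-involutive P)

rotate-unrotate : Balanced P → rotate (unrotate P) ≡ P
rotate-unrotate {P} bp = trans (rotate-mirror-rotate (Balanced-mirror bp)) (mirror-involutive P)

Balanced-unrotate : Balanced P → Balanced (unrotate P)
Balanced-unrotate = Balanced-mirror ∘ Balanced-rotate ∘ Balanced-mirror

length-unrotate : Balanced P → length (unrotate P) ≡ length P
length-unrotate {P} bp =
  trans (length-mirror (rotate (mirror P))) (trans (length-rotate (Balanced-mirror bp)) (length-mirror P))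

module _ (m : ℕ) where
  private
    n = suc m
    N = 2 * n

  cyc-first : ∀ {t} → t < N → cyc n 1 t ≡ suc t
  cyc-first t<N = cong suc (m<n⇒m%n≡m t<N)

  cyc-suc : ∀ a t → cyc n (2 + a) t ≡ next N (cyc n (suc a) t)
  cyc-suc a t = cong suc (%-suc (a + t) N)

  inInterval-first : ∀ k {v} → k ≤ N → 0 < v → not (inInterval n 1 k v) ≡ (k <ᵇ v)
  inInterval-first k {suc v} k≤N _ with suc v ≤? k
  ... | yes v<k = trans (cong not (dec-true (T? _) (any⁺ _ (applyUpTo⁺ id hit v<k)))) (sym (<ᵇ-false (≤⇒≯ v<k)))
    where hit = ≡⇒≡ᵇ _ _ (cyc-first (<-≤-trans v<k k≤N))
  ... | no v≮k = trans (cong not (dec-false (T? _) miss)) (sym (<ᵇ-true (≰⇒> v≮k)))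
    where
    miss : ¬ T (inInterval n 1 k (suc v))
    miss w with applyUpTo⁻ id (any⁻ _ _ w)
    ... | t , t<k , e = v≮k (subst (_≤ k) (trans (sym (cyc-first (<-≤-trans t<k k≤N))) (≡ᵇ⇒≡ _ _ e)) t<k)

  inInterval-next : ∀ a k {v} → 0 < v → v ≤ N → inInterval n (2 + a) k (next N v) ≡ inInterval n (suc a) k v
  inInterval-next a k {v} 0<v v≤N = cong or (map-cong pointwise (upTo k))
    where
    pointwise : ∀ t → (cyc n (2 + a) t ≡ᵇ next N v) ≡ (cyc n (suc a) t ≡ᵇ v)
    pointwise t = trans (cong (_≡ᵇ next N v) (cyc-suc a t)) (next-≡ᵇ z<s (m%n<n (a + t) N) 0<v v≤N)

  unpaired-first : Balanced P → length P ≡ N → ∀ {k} → k ≤ N → unpaired n 1 k P ≡ crossings P k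
  unpaired-first {P} bp eP {k} k≤N = trans (length-filterᵇ-applyUpTo _ id k) (countBelow-cong k pointwise)
    where
    pointwise : ∀ {t} → t < k → not (inInterval n 1 k (tunnel P (cyc n 1 t))) ≡ (k <ᵇ tunnel P (suc t))
    pointwise t<k rewrite cyc-first (<-≤-trans t<k k≤N) =
      inInterval-first k k≤N (tunnel-positive bp (subst (_ <_) (sym eP) (<-≤-trans t<k k≤N)))

  unpaired-rotate : Balanced P → length P ≡ N → ∀ a k → unpaired n (2 + a) k P ≡ unpaired n (suc a) k (rotate P)
  unpaired-rotate {P} bp eP a k = cong length (filterᵇ-cong (upTo k) (λ {t} _ → cong not (shifted t)))
    where
    open ≡-Reasoning
    R = rotate P
    bR = Balanced-rotate bp
    eR = trans (length-rotate bp) eP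
    shifted : ∀ t → inInterval n (2 + a) k (tunnel P (cyc n (2 + a) t))
                  ≡ inInterval n (suc a) k (tunnel R (cyc n (suc a) t))
    shifted t = begin
      inInterval n (2 + a) k (tunnel P (cyc n (2 + a) t))  ≡⟨ cong (inInterval n (2 + a) k ∘ tunnel P) (cyc-suc a t) ⟩
      inInterval n (2 + a) k (tunnel P (next N (suc i)))   ≡⟨ cong (inInterval n (2 + a) k) (tunnel-rotate bp eP i<N) ⟩
      inInterval n (2 + a) k (next N (tunnel R (suc i)))   ≡⟨ inInterval-next a k (tunnel-positive bR i<R) τ≤N ⟩
      inInterval n (suc a) k (tunnel R (suc i))            ∎
      where
      i = (a + t) % N
      i<N = m%n<n (a + t) N
      i<R = subst (i <_) (sym eR) i<N
      τ≤N = subst (tunnel R (suc i) ≤_) eR (tunnel-≤-length R _)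

words-length : ∀ m {w} → w ∈ words m → length w ≡ m
words-length zero    (here refl) = refl
words-length (suc m) w∈ with ∈-++⁻ (map (U ∷_) (words m)) w∈
... | inj₁ w∈U with ∈-map⁻ (U ∷_) w∈U
...   | v , v∈ , refl = cong suc (words-length m v∈)
words-length (suc m) w∈ | inj₂ w∈D with ∈-map⁻ (D ∷_) w∈D
...   | v , v∈ , refl = cong suc (words-length m v∈)

words-complete : ∀ w → w ∈ words (length w)
words-complete []      = here refl
words-complete (U ∷ w) = ∈-++⁺ˡ (∈-map⁺ (U ∷_) (words-complete w))
words-complete (D ∷ w) = ∈-++⁺ʳ (map (U ∷_) (words (length w))) (∈-map⁺ (D ∷_) (words-complete w))

words-unique : ∀ m → Unique (words m)
words-unique zero    = [] ∷ []
words-unique (suc m) =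
  Unique.++⁺ (Unique.map⁺ (∷-injective U) (words-unique m)) (Unique.map⁺ (∷-injective D) (words-unique m)) disjoint
  where
  ∷-injective : ∀ s {v w : List Step} → s ∷ v ≡ s ∷ w → v ≡ w
  ∷-injective s refl = refl
  disjoint : ∀ {w} → ¬ (w ∈ map (U ∷_) (words m) × w ∈ map (D ∷_) (words m))
  disjoint (w∈U , w∈D) with ∈-map⁻ (U ∷_) w∈U | ∈-map⁻ (D ∷_) w∈D
  ... | _ , _ , refl | _ , _ , ()

∈-Dyck⁻ : ∀ n {P} → P ∈ Dyck n → Balanced P × length P ≡ 2 * n
∈-Dyck⁻ n P∈ with ∈-filter⁻ (T? ∘ isDyck) {xs = words (2 * n)} P∈
... | P∈words , dyck = isDyck⇒Balanced (Equivalence.to T-≡ dyck) , words-length (2 * n) P∈words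

∈-Dyck⁺ : ∀ n {P} → Balanced P → length P ≡ 2 * n → P ∈ Dyck n
∈-Dyck⁺ n {P} bp eP =
  ∈-filter⁺ (T? ∘ isDyck) (subst (λ m → P ∈ words m) eP (words-complete P))
            (Equivalence.from T-≡ (Balanced⇒isDyck bp))

Dyck-unique : ∀ n → Unique (Dyck n)
Dyck-unique n = Unique.filter⁺ (T? ∘ isDyck) (words-unique (2 * n))

count-rotate : ∀ n f → count n (f ∘ rotate) ≡ count n f
count-rotate n = length-filterᵇ-∘-bijection (Dyck-unique n)
  (λ P∈ → let bp , eP = ∈-Dyck⁻ n P∈ in ∈-Dyck⁺ n (Balanced-rotate bp) (trans (length-rotate bp) eP))
  (λ P∈ → let bp , eP = ∈-Dyck⁻ n P∈ in ∈-Dyck⁺ n (Balanced-unrotate bp) (trans (length-unrotate bp) eP))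
  (unrotate-rotate ∘ proj₁ ∘ ∈-Dyck⁻ n)
  (rotate-unrotate ∘ proj₁ ∘ ∈-Dyck⁻ n)

count-cong : ∀ n {f g} → (∀ {P} → Balanced P → length P ≡ 2 * n → f P ≡ g P) → count n f ≡ count n g
count-cong n eq = cong length (filterᵇ-cong (Dyck n) (λ P∈ → let bp , eP = ∈-Dyck⁻ n P∈ in eq bp eP))

heightIs-+ : ∀ {k ℓ P v} → ℤ.+ v ≡ height k P → (v ≡ᵇ ℓ) ≡ heightIs k ℓ P
heightIs-+ {ℓ = ℓ} {v = v} e =
  trans (sym (isYes≗does (ℤ.+ v ℤᵖ.≟ ℤ.+ ℓ))) (cong (λ h → ⌊ h ℤᵖ.≟ ℤ.+ ℓ ⌋) e)

count-unpaired≡count-height : ∀ m k ℓ → k ≤ 2 * suc m → ∀ a →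
  count (suc m) (λ P → unpaired (suc m) (suc a) k P ≡ᵇ ℓ) ≡ count (suc m) (heightIs k ℓ)
count-unpaired≡count-height m k ℓ k≤2n zero = count-cong (suc m) λ bp eP →
  trans (cong (_≡ᵇ ℓ) (unpaired-first m bp eP k≤2n))
        (heightIs-+ {k} (crossings≡height bp k (subst (k ≤_) (sym eP) k≤2n)))
count-unpaired≡count-height m k ℓ k≤2n (suc a) = begin
  count (suc m) (λ P → unpaired (suc m) (2 + a) k P ≡ᵇ ℓ)
    ≡⟨ count-cong (suc m) (λ bp eP → cong (_≡ᵇ ℓ) (unpaired-rotate m bp eP a k)) ⟩
  count (suc m) (λ P → unpaired (suc m) (suc a) k (rotate P) ≡ᵇ ℓ)
    ≡⟨ count-rotate (suc m) (λ P → unpaired (suc m) (suc a) k P ≡ᵇ ℓ) ⟩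
  count (suc m) (λ P → unpaired (suc m) (suc a) k P ≡ᵇ ℓ)
    ≡⟨ count-unpaired≡count-height m k ℓ k≤2n a ⟩
  count (suc m) (heightIs k ℓ)                                    ∎
  where open ≡-Reasoning

corollary2 : (n a k ℓ : ℕ) → 1 ≤ n → 1 ≤ a → a ≤ 2 * n → 1 ≤ k → k ≤ 2 * n → 1 ≤ ℓ → ℓ ≤ n →
    count n (λ P → unpaired n a k P ≡ᵇ ℓ) ≡ count n (heightIs k ℓ)
corollary2 (suc m) (suc a) k ℓ _ _ _ _ k≤2n _ _ = count-unpaired≡count-height m k ℓ k≤2n a
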